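{- Let $S$ be a set of clauses, let $M_{g(S)}$ be a model of $g(S)$, and let $F(S) = Filter(Gr(ng(S)), M_{g(S)})$. Let $D$ be a clause in $S$, let $\theta$ be a ground substitution, and let $D' = Filter(D\theta, M_{g(S)})$. Then: (a) if $D$ is a tautology, then either $D'\notin F(S)$ or $D'$ is a tautology; (b) if $D$ is subsumed by some clause of $S$, then either $D'\notin F(S)$ or there is a clause $C'\in F(S)$ such that $C'\subseteq D'$.
   Context: First-order logic without equality. A literal is an atom or its negation; $\bar L$ denotes the complement of $L$ ($\bar A=\neg A$, $\overline{\neg A}=A$). A clause is a finite multiset of literals read as a disjunction. A clause is ground if it contains no variables. For a set of clauses $S$, $g(S)$ is the set of ground clauses in $S$ and $ng(S)$ the set of non-ground clauses in $S$. For a clause $C$, $Gr(C)=\{C\theta : C\theta \text{ is ground}\}$ and $Gr(S)=\bigcup_{C\in S}Gr(C)$. A (partial) interpretation is a consistent set $I$ of ground literals; $I\models L$ iff $L\in I$; for a ground clause $C$, $I\models C$ iff $I\cap C\neq\emptyset$; for a non-ground clause $C$, $I\models C$ iff $I\models Gr(C)$; $I$ is a model of a set of clauses if it satisfies each of them. For a ground clause $C$, $Filter(C,I)=\{L\in C : I\not\models \bar L\}$; for a set $S$ of ground clauses, $Filter(S,I)=\{Filter(C,I) : C\in S,\ I\not\models C\}$. A clause $C$ subsumes a clause $D$ if $C\sigma\subseteq D$ for some substitution $\sigma$. A clause is a tautology if it contains both $A$ and $\neg A$ for some atom $A$. -}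

module Defs where

open import Data.Nat using (ℕ)
open import Data.Bool using (Bool; true; false; not)
open import Data.Empty using (⊥)
open import Data.Unit using (⊤)
open import Data.Product using (Σ; ∃; ∃-syntax; _×_; _,_)
open import Data.Vec using (Vec; []; _∷_)
open import Data.List using (List; []; _∷_; _++_; filterᵇ)
open import Data.List.Relation.Unary.All using (All)
open import Data.List.Relation.Unary.Any using (Any)
open import Data.List.Membership.Propositional using (_∈_)
open import Data.List.Relation.Binary.Permutation.Propositional using (_↭_)
open import Relation.Binary.PropositionalEquality using (_≡_)
open import Relation.Nullary using (¬_)

record Signature : Set₁ where
  field
    Fun    : Set
    Pred   : Set
    funAr  : Fun → ℕ
    predAr : Pred → ℕ

module FOL (sig : Signature) where
  open Signature sig

  data Term : Set where
    var : ℕ → Term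
    fn  : (f : Fun) → Vec Term (funAr f) → Term

  data Atom : Set where
    atom : (p : Pred) → Vec Term (predAr p) → Atom

  data Literal : Set where
    pos : Atom → Literal
    neg : Atom → Literal

  comp : Literal → Literal
  comp (pos A) = neg A
  comp (neg A) = pos A

  -- a clause is a finite multiset of literals: a list, up to permutation (_↭_)
  Clause : Set
  Clause = List Literal

  ClauseSet : Set₁
  ClauseSet = Clause → Set

  mutual
    GroundTerm : Term → Set
    GroundTerm (var _)   = ⊥
    GroundTerm (fn f ts) = GroundTerms ts

    GroundTerms : ∀ {n} → Vec Term n → Set
    GroundTerms []       = ⊤
    GroundTerms (t ∷ ts) = GroundTerm t × GroundTerms ts

  GroundAtom : Atom → Set
  GroundAtom (atom p ts) = GroundTerms ts

  GroundLit : Literal → Set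
  GroundLit (pos A) = GroundAtom A
  GroundLit (neg A) = GroundAtom A

  GroundClause : Clause → Set
  GroundClause C = All GroundLit C

  NonGroundClause : Clause → Set
  NonGroundClause C = ¬ GroundClause C

  Subst : Set
  Subst = ℕ → Term

  mutual
    substT : Subst → Term → Term
    substT σ (var x)   = σ x
    substT σ (fn f ts) = fn f (substTs σ ts)

    substTs : ∀ {n} → Subst → Vec Term n → Vec Term n
    substTs σ []       = []
    substTs σ (t ∷ ts) = substT σ t ∷ substTs σ ts

  substA : Subst → Atom → Atom
  substA σ (atom p ts) = atom p (substTs σ ts)

  substL : Subst → Literal → Literal
  substL σ (pos A) = pos (substA σ A)
  substL σ (neg A) = neg (substA σ A)

  substC : Subst → Clause → Clause
  substC σ []      = []
  substC σ (L ∷ C) = substL σ L ∷ substC σ C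

  GroundSubst : Subst → Set
  GroundSubst θ = ∀ x → GroundTerm (θ x)

  _⊆ₘ_ : Clause → Clause → Set
  C ⊆ₘ D = Σ Clause λ E → (C ++ E) ↭ D

  Subsumes : Clause → Clause → Set
  Subsumes C D = Σ Subst λ σ → substC σ C ⊆ₘ D

  Tautology : Clause → Set
  Tautology C = Σ Atom λ A → (pos A ∈ C) × (neg A ∈ C)

  -- a partial interpretation: a consistent set of ground literals,
  -- given by its characteristic function
  record Interp : Set where
    field
      mem        : Literal → Bool
      ground     : ∀ L → mem L ≡ true → GroundLit L
      consistent : ∀ L → mem L ≡ true → mem (comp L) ≡ true → ⊥
  open Interp public

  _⊨L_ : Interp → Literal → Set
  I ⊨L L = mem I L ≡ true

  _⊨g_ : Interp → Clause → Set
  I ⊨g C = Any (λ L → I ⊨L L) C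

  _⊨_ : Interp → Clause → Set
  I ⊨ C = ∀ σ → GroundClause (substC σ C) → I ⊨g substC σ C

  ModelOfGround : Interp → ClauseSet → Set
  ModelOfGround I S = ∀ C → S C → GroundClause C → I ⊨ C

  Filter : Clause → Interp → Clause
  Filter C I = filterᵇ (λ L → not (mem I (comp L))) C

  -- D' ∈ F(S) = Filter(Gr(ng(S)), I)
  --   = { Filter(E, I) : E ∈ Gr(ng(S)), I ⊭ E }   (clauses compared as multisets)
  InF : ClauseSet → Interp → Clause → Set
  InF S I D' =
    Σ Clause λ C → S C × NonGroundClause C ×
      Σ Subst λ σ → GroundClause (substC σ C) ×
        ¬ (I ⊨g substC σ C) × (Filter (substC σ C) I ↭ D')

-- Every clause of F(S) is falsified by M, so a filtered instance D' containing a
-- literal true in M is not in F(S).  This settles (a) when M makes one of the two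
-- complementary literals of Dθ true; otherwise both survive filtering and D' is a
-- tautology.  For (b), if Cσ ⊆ D then C(θσ) ⊆ Dθ; either M satisfies C(θσ), hence
-- Dθ, or C(θσ) is falsified, which forces C to be non-ground (M is a model of g(S)),
-- so Filter(C(θσ), M) is a clause of F(S) contained in D'.
module Submission where

open import Defs
open import Function using (_∘_)
open import Data.Bool using (true; false; not; T)
open import Data.Bool.Properties using (T?) renaming (_≟_ to _≟ᵇ_)
open import Data.Unit using (tt)
open import Data.Empty using (⊥-elim)
open import Data.Product using (Σ; _×_; _,_; proj₁)
open import Data.Sum using (_⊎_; inj₁; inj₂; [_,_]′)
open import Data.Vec using (Vec; []; _∷_)
open import Data.List using ([]; _∷_; _++_; map)
open import Data.List.Properties using (filter-++)
open import Data.List.Relation.Unary.All using ([]; _∷_)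
open import Data.List.Relation.Unary.All.Properties using (++⁻ˡ)
open import Data.List.Relation.Unary.Any using (any?)
open import Data.List.Relation.Unary.Any.Properties using (++⁺ˡ)
open import Data.List.Membership.Propositional using (_∈_; find; lose)
open import Data.List.Membership.Propositional.Properties using (∈-map⁺; ∈-filter⁺; ∈-filter⁻)
open import Data.List.Relation.Binary.Permutation.Propositional using (_↭_; ↭-refl; ↭-sym)
open import Data.List.Relation.Binary.Permutation.Propositional.Properties
  using (map⁺; filter-↭; All-resp-↭; Any-resp-↭; ∈-resp-↭)
open import Relation.Nullary using (¬_; Dec; yes; no)
open import Relation.Binary.PropositionalEquality using (_≡_; refl; sym; cong; cong₂; subst; subst₂)

module Clauses (sig : Signature) where
  open FOL sig

  _∘ₛ_ : Subst → Subst → Subst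
  (θ ∘ₛ σ) x = substT θ (σ x)

  mutual
    substT-∘ : ∀ θ σ t → substT θ (substT σ t) ≡ substT (θ ∘ₛ σ) t
    substT-∘ θ σ (var x)   = refl
    substT-∘ θ σ (fn f ts) = cong (fn f) (substTs-∘ θ σ ts)

    substTs-∘ : ∀ {n} θ σ (ts : Vec Term n) → substTs θ (substTs σ ts) ≡ substTs (θ ∘ₛ σ) ts
    substTs-∘ θ σ []       = refl
    substTs-∘ θ σ (t ∷ ts) = cong₂ _∷_ (substT-∘ θ σ t) (substTs-∘ θ σ ts)

  substL-∘ : ∀ θ σ L → substL θ (substL σ L) ≡ substL (θ ∘ₛ σ) L
  substL-∘ θ σ (pos (atom p ts)) = cong (pos ∘ atom p) (substTs-∘ θ σ ts)
  substL-∘ θ σ (neg (atom p ts)) = cong (neg ∘ atom p) (substTs-∘ θ σ ts)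

  substC-∘ : ∀ θ σ C → substC θ (substC σ C) ≡ substC (θ ∘ₛ σ) C
  substC-∘ θ σ []      = refl
  substC-∘ θ σ (L ∷ C) = cong₂ _∷_ (substL-∘ θ σ L) (substC-∘ θ σ C)

  substC≡map : ∀ θ C → substC θ C ≡ map (substL θ) C
  substC≡map θ []      = refl
  substC≡map θ (L ∷ C) = cong (substL θ L ∷_) (substC≡map θ C)

  substC-++ : ∀ θ C D → substC θ (C ++ D) ≡ substC θ C ++ substC θ D
  substC-++ θ []      D = refl
  substC-++ θ (L ∷ C) D = cong (substL θ L ∷_) (substC-++ θ C D)

  substC-↭ : ∀ θ {C D} → C ↭ D → substC θ C ↭ substC θ D
  substC-↭ θ {C} {D} C↭D =
    subst₂ _↭_ (sym (substC≡map θ C)) (sym (substC≡map θ D)) (map⁺ (substL θ) C↭D)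

  ∈-substC : ∀ θ {L C} → L ∈ C → substL θ L ∈ substC θ C
  ∈-substC θ {C = C} L∈C = subst (_ ∈_) (sym (substC≡map θ C)) (∈-map⁺ (substL θ) L∈C)

  mutual
    substT-ground : ∀ {θ} → GroundSubst θ → ∀ t → GroundTerm (substT θ t)
    substT-ground gθ (var x)   = gθ x
    substT-ground gθ (fn f ts) = substTs-ground gθ ts

    substTs-ground : ∀ {n θ} → GroundSubst θ → (ts : Vec Term n) → GroundTerms (substTs θ ts)
    substTs-ground gθ []       = tt
    substTs-ground gθ (t ∷ ts) = substT-ground gθ t , substTs-ground gθ ts

  substC-ground : ∀ {θ} → GroundSubst θ → ∀ C → GroundClause (substC θ C)
  substC-ground gθ []                    = []
  substC-ground gθ (pos (atom p ts) ∷ C) = substTs-ground gθ ts ∷ substC-ground gθ C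
  substC-ground gθ (neg (atom p ts) ∷ C) = substTs-ground gθ ts ∷ substC-ground gθ C

  Tautology-substC : ∀ θ {C} → Tautology C → Tautology (substC θ C)
  Tautology-substC θ (A , A∈C , ¬A∈C) = substA θ A , ∈-substC θ A∈C , ∈-substC θ ¬A∈C

  ⊆ₘ-substC : ∀ θ {C D} → C ⊆ₘ D → substC θ C ⊆ₘ substC θ D
  ⊆ₘ-substC θ {C} (E , C++E↭D) =
    substC θ E , subst (_↭ _) (substC-++ θ C E) (substC-↭ θ C++E↭D)

  ⊆ₘ-substC-∘ : ∀ θ σ {C D} → substC σ C ⊆ₘ D → substC (θ ∘ₛ σ) C ⊆ₘ substC θ D
  ⊆ₘ-substC-∘ θ σ {C} Cσ⊆D = subst (_⊆ₘ _) (substC-∘ θ σ C) (⊆ₘ-substC θ Cσ⊆D)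

  GroundClause-⊆ₘ : ∀ {C D} → C ⊆ₘ D → GroundClause D → GroundClause C
  GroundClause-⊆ₘ {C} (E , C++E↭D) gD = ++⁻ˡ C (All-resp-↭ (↭-sym C++E↭D) gD)

  _⊨g?_ : ∀ I C → Dec (I ⊨g C)
  I ⊨g? C = any? (λ L → mem I L ≟ᵇ true) C

  module _ (I : Interp) where

    -- Filter C I is  filter keep? C  on the nose, because  filterᵇ p = filter (T? ∘ p).
    Kept : Literal → Set
    Kept L = T (not (mem I (comp L)))

    keep? : ∀ L → Dec (Kept L)
    keep? L = T? (not (mem I (comp L)))

    Kept-if-comp-false : ∀ {L} → mem I (comp L) ≡ false → Kept L
    Kept-if-comp-false eq rewrite eq = tt

    Kept-if-true : ∀ {L} → I ⊨L L → Kept L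
    Kept-if-true {L} I⊨L with mem I (comp L) in eq
    ... | true  = ⊥-elim (consistent I L I⊨L eq)
    ... | false = tt

    ⊨g-⊆ₘ : ∀ {C D} → C ⊆ₘ D → I ⊨g C → I ⊨g D
    ⊨g-⊆ₘ (E , C++E↭D) I⊨C = Any-resp-↭ C++E↭D (++⁺ˡ I⊨C)

    Filter-⊆ₘ : ∀ {C D} → C ⊆ₘ D → Filter C I ⊆ₘ Filter D I
    Filter-⊆ₘ {C} (E , C++E↭D) =
      Filter E I , subst (_↭ _) (filter-++ keep? C E) (filter-↭ keep? C++E↭D)

    Filter-Tautology : ∀ {C} → Tautology C → I ⊨g C ⊎ Tautology (Filter C I)
    Filter-Tautology (A , A∈C , ¬A∈C) with mem I (pos A) in posEq | mem I (neg A) in negEq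
    ... | true  | _     = inj₁ (lose A∈C posEq)
    ... | false | true  = inj₁ (lose ¬A∈C negEq)
    ... | false | false = inj₂ (A , ∈-filter⁺ keep? A∈C (Kept-if-comp-false negEq)
                                  , ∈-filter⁺ keep? ¬A∈C (Kept-if-comp-false posEq))

    module _ (S : ClauseSet) where

      InF-falsified : ∀ {D' L} → InF S I D' → L ∈ D' → ¬ I ⊨L L
      InF-falsified (_ , _ , _ , _ , _ , I⊭Eσ , Eσ↭D') L∈D' I⊨L =
        I⊭Eσ (lose (proj₁ (∈-filter⁻ keep? (∈-resp-↭ (↭-sym Eσ↭D') L∈D'))) I⊨L)

      ¬InF-Filter-satisfied : ∀ {C} → I ⊨g C → ¬ InF S I (Filter C I)
      ¬InF-Filter-satisfied I⊨C C'∈F with find I⊨C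
      ... | L , L∈C , I⊨L = InF-falsified C'∈F (∈-filter⁺ keep? L∈C (Kept-if-true I⊨L)) I⊨L

      -- C is non-ground because I, a model of g(S), falsifies its instance.
      InF-Filter-falsified : ModelOfGround I S → ∀ {C σ} → S C → GroundClause (substC σ C) →
                             ¬ I ⊨g substC σ C → InF S I (Filter (substC σ C) I)
      InF-Filter-falsified model {C} {σ} C∈S gCσ I⊭Cσ =
        C , C∈S , (λ gC → I⊭Cσ (model C C∈S gC σ gCσ)) , σ , gCσ , I⊭Cσ , ↭-refl

      Filter-instance : ModelOfGround I S → ∀ {C σ G} → S C → substC σ C ⊆ₘ G → GroundClause G →
                        ¬ InF S I (Filter G I) ⊎ (Σ Clause λ C' → InF S I C' × (C' ⊆ₘ Filter G I))
      Filter-instance model {C} {σ} C∈S Cσ⊆G gG with I ⊨g? substC σ C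
      ... | yes I⊨Cσ = inj₁ (¬InF-Filter-satisfied (⊨g-⊆ₘ Cσ⊆G I⊨Cσ))
      ... | no I⊭Cσ  = inj₂ (Filter (substC σ C) I
                            , InF-Filter-falsified model C∈S (GroundClause-⊆ₘ Cσ⊆G gG) I⊭Cσ
                            , Filter-⊆ₘ Cσ⊆G)

mainTheorem3 : (sig : Signature) → let open FOL sig in
    (S : ClauseSet) (M : Interp) → ModelOfGround M S →
    (D : Clause) → S D → (θ : Subst) → GroundSubst θ →
    ((Tautology D →
    ¬ InF S M (Filter (substC θ D) M) ⊎ Tautology (Filter (substC θ D) M))
    × ((Σ Clause λ C → S C × Subsumes C D) →
    ¬ InF S M (Filter (substC θ D) M)
    ⊎ (Σ Clause λ C' → InF S M C' × (C' ⊆ₘ Filter (substC θ D) M))))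
mainTheorem3 sig S M model D _ θ gθ =
  (λ taut → [ inj₁ ∘ ¬InF-Filter-satisfied M S , inj₂ ]′
              (Filter-Tautology M (Tautology-substC θ taut)))
  , λ { (C , C∈S , σ , Cσ⊆D) →
          Filter-instance M S model C∈S (⊆ₘ-substC-∘ θ σ Cσ⊆D) (substC-ground gθ D) }
  where open Clauses sig
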